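{- For integers $t,a,b,r$ with $a\ge2$ and $b\ge1$, define \[f(t,a,b,r)=\sum_{i=1}^{a-1}(-1)^{a+i}\binom{t-1}{i-1}\binom{t-2-a+r+i}{b-1},\] \[g(t,a,b,r)=-\binom{t-2}{a-2}\binom{t-2+r}{b-1}+\sum_{i=1}^{a-1}(-1)^{a+i+1}\binom{t-2}{i-1}\binom{t-2-a+r+i}{b-2}.\] Then $f(t,a,b,r)=g(t,a,b,r)$ for all such $t,a,b,r$.
   Context: For any integer $x$ (possibly negative) and integer $k\ge0$, $\binom{x}{k}=\frac{x(x-1)\cdots(x-k+1)}{k!}$; for $k<0$, $\binom{x}{k}=0$. -}

module Defs where

open import Data.Nat as ℕ using (ℕ; zero; suc; _!)
open import Data.Nat.Properties using (_!≢0)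
open import Data.Integer using (ℤ; +_; -[1+_]; _+_; _-_; _*_; -_; 0ℤ; 1ℤ)
open import Data.Integer.DivMod using (_/ℕ_)

falling : ℤ → ℕ → ℤ
falling x zero    = 1ℤ
falling x (suc k) = falling x k * (x - + k)

-- generalized binomial: binom x k = x(x-1)...(x-k+1)/k! for k ≥ 0, 0 for k < 0
-- (the division is exact; _/ℕ_ is floor division by the positive natural k!)
binom : ℤ → ℤ → ℤ
binom x (+ k)      = _/ℕ_ (falling x k) (k !) ⦃ k !≢0 ⦄
binom x -[1+ _ ]   = 0ℤ

sgnℕ : ℕ → ℤ
sgnℕ zero          = 1ℤ
sgnℕ (suc zero)    = - 1ℤ
sgnℕ (suc (suc n)) = sgnℕ n

sgn : ℤ → ℤ
sgn (+ n)    = sgnℕ n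
sgn -[1+ n ] = - sgnℕ n

sumFrom1 : ℕ → (ℤ → ℤ) → ℤ
sumFrom1 zero    h = 0ℤ
sumFrom1 (suc n) h = sumFrom1 n h + h (+ suc n)

toℕ : ℤ → ℕ
toℕ (+ n)    = n
toℕ -[1+ _ ] = 0

f : ℤ → ℤ → ℤ → ℤ → ℤ
f t a b r = sumFrom1 (toℕ (a - 1ℤ)) λ i →
  sgn (a + i) * binom (t - 1ℤ) (i - 1ℤ) * binom (t - + 2 - a + r + i) (b - 1ℤ)

g : ℤ → ℤ → ℤ → ℤ → ℤ
g t a b r = - (binom (t - + 2) (a - + 2) * binom (t - + 2 + r) (b - 1ℤ))
  + sumFrom1 (toℕ (a - 1ℤ)) λ i →
      sgn (a + i + 1ℤ) * binom (t - + 2) (i - 1ℤ) * binom (t - + 2 - a + r + i) (b - + 2)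

-- Pascal's rule binom (1+y) (1+k) = binom y (1+k) + binom y k holds for all integers y, k.
-- Splitting binom (t-1) (i-1) by it, and merging binom y (b-1) + binom y (b-2) into
-- binom (1+y) (b-1), turns the i-th summand of f into the i-th summand of g plus
-- (-1)^(a+i) (U i + U (i-1)), where U i = binom (t-2) (i-1) * binom (t-1-a+r+i) (b-1).
-- The alternating signs make this telescope; U 0 = 0, and the surviving term -U (a-1)
-- is the first term of g.
module Submission where

open import Data.Nat as ℕ using (ℕ; zero; suc; _!; z≤n; s≤s)
open import Data.Nat.Properties as ℕ using (_!≢0)
import Data.Nat.DivMod as ℕ
open import Data.Integer using (ℤ; +_; -[1+_]; _+_; _-_; _*_; -_; 0ℤ; 1ℤ; -1ℤ; _≤_; +≤+; _/ℕ_)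
open import Data.Integer.Properties using (*-cancelʳ-≡; pos-*; +-identityʳ; *-zeroʳ; neg-involutive)
open import Data.Integer.Divisibility.Signed using (_∣_; divides; ∣-refl; *-monoʳ-∣; ∣m∣n⇒∣m+n; ∣m+n∣n⇒∣m)
open import Data.Integer.Tactic.RingSolver using (solve-∀)
open import Relation.Binary.PropositionalEquality using (_≡_; refl; sym; trans; cong; cong₂; subst; module ≡-Reasoning)
open import Defs

falling-suc : ∀ x k → falling x (suc k) ≡ x * falling (x - 1ℤ) k
falling-suc x zero = ring x
  where ring : ∀ x → 1ℤ * (x - + 0) ≡ x * 1ℤ
        ring = solve-∀
falling-suc x (suc k) = begin
  falling x (suc k) * (x - + suc k)         ≡⟨ cong (_* (x - + suc k)) (falling-suc x k) ⟩
  x * falling (x - 1ℤ) k * (x - + suc k)    ≡⟨ ring x (falling (x - 1ℤ) k) (+ k) ⟩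
  x * (falling (x - 1ℤ) k * (x - 1ℤ - + k)) ∎
  where open ≡-Reasoning
        ring : ∀ x F k → x * F * (x - (1ℤ + k)) ≡ x * (F * (x - 1ℤ - k))
        ring = solve-∀

falling-pascal : ∀ y k → falling (1ℤ + y) (suc k) ≡ falling y (suc k) + + suc k * falling y k
falling-pascal y k = begin
  falling (1ℤ + y) (suc k)             ≡⟨ falling-suc (1ℤ + y) k ⟩
  (1ℤ + y) * falling (1ℤ + y - 1ℤ) k   ≡⟨ cong (λ z → (1ℤ + y) * falling z k) (ring₁ y) ⟩
  (1ℤ + y) * falling y k               ≡⟨ ring₂ y (falling y k) (+ k) ⟩
  falling y k * (y - + k) + (1ℤ + + k) * falling y k ∎
  where open ≡-Reasoning
        ring₁ : ∀ y → 1ℤ + y - 1ℤ ≡ y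
        ring₁ = solve-∀
        ring₂ : ∀ y F k → (1ℤ + y) * F ≡ F * (y - k) + (1ℤ + k) * F
        ring₂ = solve-∀

suc!≡suc*! : ∀ k → + (suc k !) ≡ + suc k * + (k !)
suc!≡suc*! k = pos-* (suc k) (k !)

-- This is what makes the floor division in binom exact.
k!∣falling : ∀ k x → + (k !) ∣ falling x k
k!∣falling zero    x = ∣-refl
k!∣falling (suc k) x = all x
  where
  d = + (suc k !)

  d∣tail : ∀ y → d ∣ + suc k * falling y k
  d∣tail y = subst (_∣ + suc k * falling y k) (sym (suc!≡suc*! k)) (*-monoʳ-∣ (+ suc k) (k!∣falling k y))

  lower : ∀ y → d ∣ falling (1ℤ + y) (suc k) → d ∣ falling y (suc k)
  lower y d∣ = ∣m+n∣n⇒∣m (subst (d ∣_) (falling-pascal y k) d∣) (d∣tail y)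

  nonneg : ∀ n → d ∣ falling (+ n) (suc k)
  nonneg zero    = divides 0ℤ (falling-suc 0ℤ k)
  nonneg (suc n) = subst (d ∣_) (sym (falling-pascal (+ n) k)) (∣m∣n⇒∣m+n (nonneg n) (d∣tail (+ n)))

  neg : ∀ m → d ∣ falling -[1+ m ] (suc k)
  neg zero    = lower -[1+ 0 ] (nonneg 0)
  neg (suc m) = lower -[1+ suc m ] (neg m)

  all : ∀ x → d ∣ falling x (suc k)
  all (+ n)    = nonneg n
  all -[1+ m ] = neg m

[q*d]/ℕd≡q : ∀ q d .{{_ : ℕ.NonZero d}} → (q * + d) /ℕ d ≡ q
[q*d]/ℕd≡q (+ m) d = trans (cong (_/ℕ d) (sym (pos-* m d))) (cong +_ (ℕ.m*n/n≡m m d))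
[q*d]/ℕd≡q -[1+ m ] (suc d) = negative (ℕ.m*n%n≡0 (suc m) (suc d))
  where
  negative : suc (d ℕ.+ m ℕ.* suc d) ℕ.% suc d ≡ 0 → -[1+ d ℕ.+ m ℕ.* suc d ] /ℕ suc d ≡ -[1+ m ]
  negative eq with suc (d ℕ.+ m ℕ.* suc d) ℕ.% suc d
  ... | zero = cong (λ n → - (+ n)) (ℕ.m*n/n≡m (suc m) (suc d))

binom*!≡falling : ∀ x k → binom x (+ k) * + (k !) ≡ falling x k
binom*!≡falling x k with k!∣falling k x
... | divides q eq = begin
  falling x k /k! * + (k !)   ≡⟨ cong (λ z → z /k! * + (k !)) eq ⟩
  (q * + (k !)) /k! * + (k !) ≡⟨ cong (_* + (k !)) ([q*d]/ℕd≡q q (k !) ⦃ k !≢0 ⦄) ⟩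
  q * + (k !)                 ≡⟨ sym eq ⟩
  falling x k                 ∎
  where open ≡-Reasoning
        _/k! : ℤ → ℤ
        z /k! = (z /ℕ (k !)) ⦃ k !≢0 ⦄

binom-pascal : ∀ y k → binom (1ℤ + y) (1ℤ + k) ≡ binom y (1ℤ + k) + binom y k
binom-pascal y (+ k) = *-cancelʳ-≡ _ _ (+ (suc k !)) ⦃ suc k !≢0 ⦄ (begin
  binom (1ℤ + y) (+ suc k) * + (suc k !)           ≡⟨ binom*!≡falling (1ℤ + y) (suc k) ⟩
  falling (1ℤ + y) (suc k)                         ≡⟨ falling-pascal y k ⟩
  falling y (suc k) + + suc k * falling y k        ≡⟨ cong₂ (λ u v → u + + suc k * v)
                                                             (sym (binom*!≡falling y (suc k))) (sym (binom*!≡falling y k)) ⟩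
  B₁ * + (suc k !) + + suc k * (B₀ * + (k !))      ≡⟨ cong (λ z → B₁ * + (suc k !) + z) (ring (+ suc k) B₀ (+ (k !))) ⟩
  B₁ * + (suc k !) + B₀ * (+ suc k * + (k !))      ≡⟨ cong (λ z → B₁ * + (suc k !) + B₀ * z) (sym (suc!≡suc*! k)) ⟩
  B₁ * + (suc k !) + B₀ * + (suc k !)              ≡⟨ distrib B₁ B₀ (+ (suc k !)) ⟩
  (B₁ + B₀) * + (suc k !)                          ∎)
  where open ≡-Reasoning
        B₁ = binom y (+ suc k)
        B₀ = binom y (+ k)
        ring : ∀ a q b → a * (q * b) ≡ q * (a * b)
        ring = solve-∀
        distrib : ∀ a b c → a * c + b * c ≡ (a + b) * c
        distrib = solve-∀
binom-pascal y -[1+ zero ]  = refl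
binom-pascal y -[1+ suc _ ] = refl

binom-pascal-at : ∀ {x k} y l → x ≡ 1ℤ + y → k ≡ 1ℤ + l → binom x k ≡ binom y k + binom y l
binom-pascal-at y l refl refl = binom-pascal y l

sgnℕ-suc : ∀ n → sgnℕ (suc n) ≡ - sgnℕ n
sgnℕ-suc zero          = refl
sgnℕ-suc (suc zero)    = refl
sgnℕ-suc (suc (suc n)) = sgnℕ-suc n

sgn-suc : ∀ z → sgn (1ℤ + z) ≡ - sgn z
sgn-suc (+ n)        = sgnℕ-suc n
sgn-suc -[1+ zero ]  = refl
sgn-suc -[1+ suc m ] = sym (trans (neg-involutive (sgnℕ (suc m))) (sgnℕ-suc m))

sgnℕ[n+suc[n]]≡-1 : ∀ n → sgnℕ (n ℕ.+ suc n) ≡ -1ℤ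
sgnℕ[n+suc[n]]≡-1 zero    = refl
sgnℕ[n+suc[n]]≡-1 (suc n) = trans (cong (λ m → sgnℕ (suc m)) (ℕ.+-suc n (suc n))) (sgnℕ[n+suc[n]]≡-1 n)

sumFrom1-telescope : ∀ (s F G U : ℤ → ℤ) →
  (∀ n → s (+ suc n) ≡ - s (+ n)) →
  (∀ i → F i ≡ G i + s i * (U i + U (i - 1ℤ))) →
  ∀ N → sumFrom1 N F + s (+ 0) * U (+ 0) ≡ sumFrom1 N G + s (+ N) * U (+ N)
sumFrom1-telescope s F G U s-alternates F≡G+ΔU zero    = refl
sumFrom1-telescope s F G U s-alternates F≡G+ΔU (suc N) = begin
  sumFrom1 N F + F i + s₀ * U (+ 0)                     ≡⟨ ring (sumFrom1 N F) (F i) (s₀ * U (+ 0)) ⟩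
  sumFrom1 N F + s₀ * U (+ 0) + F i                     ≡⟨ cong₂ _+_ (sumFrom1-telescope s F G U s-alternates F≡G+ΔU N) (F≡G+ΔU i) ⟩
  sumFrom1 N G + s (+ N) * U (+ N) + (G i + s i * (U i + U (+ N)))
                                                        ≡⟨ cong (λ z → sumFrom1 N G + z * U (+ N) + (G i + s i * (U i + U (+ N)))) sN≡-si ⟩
  sumFrom1 N G + - s i * U (+ N) + (G i + s i * (U i + U (+ N)))
                                                        ≡⟨ cancel (sumFrom1 N G) (s i) (U (+ N)) (G i) (U i) ⟩
  sumFrom1 N G + G i + s i * U i                        ∎
  where open ≡-Reasoning
        i = + suc N
        s₀ = s (+ 0)
        sN≡-si : s (+ N) ≡ - s i
        sN≡-si = trans (sym (neg-involutive (s (+ N)))) (cong -_ (sym (s-alternates N)))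
        ring : ∀ S x y → S + x + y ≡ S + y + x
        ring = solve-∀
        cancel : ∀ S σ V Gi W → S + - σ * V + (Gi + σ * (W + V)) ≡ S + Gi + σ * W
        cancel = solve-∀

module Summands (t a b r : ℤ) where

  shifted : ℤ → ℤ
  shifted i = t - + 2 - a + r + i

  fTerm gTerm boundary : ℤ → ℤ
  fTerm i    = sgn (a + i) * binom (t - 1ℤ) (i - 1ℤ) * binom (shifted i) (b - 1ℤ)
  gTerm i    = sgn (a + i + 1ℤ) * binom (t - + 2) (i - 1ℤ) * binom (shifted i) (b - + 2)
  boundary i = binom (t - + 2) (i - 1ℤ) * binom (1ℤ + shifted i) (b - 1ℤ)

  fTerm≡gTerm+Δboundary : ∀ i → fTerm i ≡ gTerm i + sgn (a + i) * (boundary i + boundary (i - 1ℤ))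
  fTerm≡gTerm+Δboundary i = begin
    σ * binom (t - 1ℤ) (i - 1ℤ) * B                   ≡⟨ cong (λ z → σ * z * B)
                                                              (binom-pascal-at (t - + 2) (i - 1ℤ - 1ℤ) (ring₁ t) (ring₂ i)) ⟩
    σ * (P + P′) * B                                  ≡⟨ split σ P P′ B D ⟩
    - σ * P * D + σ * (P * (B + D) + P′ * B)          ≡⟨ cong₂ (λ s z → s * P * D + σ * (P * z + P′ * B)) σ-flip
                                                                (sym (binom-pascal-at (shifted i) (b - + 2) refl (ring₃ b))) ⟩
    gTerm i + σ * (boundary i + P′ * B)               ≡⟨ cong (λ y → gTerm i + σ * (boundary i + P′ * binom y (b - 1ℤ)))
                                                              (sym (ring₄ t a r i)) ⟩
    gTerm i + σ * (boundary i + boundary (i - 1ℤ))    ∎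
    where
    open ≡-Reasoning
    σ  = sgn (a + i)
    P  = binom (t - + 2) (i - 1ℤ)
    P′ = binom (t - + 2) (i - 1ℤ - 1ℤ)
    B  = binom (shifted i) (b - 1ℤ)
    D  = binom (shifted i) (b - + 2)
    ring₁ : ∀ t → t - 1ℤ ≡ 1ℤ + (t - + 2)
    ring₁ = solve-∀
    ring₂ : ∀ i → i - 1ℤ ≡ 1ℤ + (i - 1ℤ - 1ℤ)
    ring₂ = solve-∀
    ring₃ : ∀ b → b - 1ℤ ≡ 1ℤ + (b - + 2)
    ring₃ = solve-∀
    ring₄ : ∀ t a r i → 1ℤ + (t - + 2 - a + r + (i - 1ℤ)) ≡ t - + 2 - a + r + i
    ring₄ = solve-∀
    ring₅ : ∀ z → z + 1ℤ ≡ 1ℤ + z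
    ring₅ = solve-∀
    split : ∀ σ P P′ B D → σ * (P + P′) * B ≡ - σ * P * D + σ * (P * (B + D) + P′ * B)
    split = solve-∀
    σ-flip : - σ ≡ sgn (a + i + 1ℤ)
    σ-flip = sym (trans (cong sgn (ring₅ (a + i))) (sgn-suc (a + i)))

  sgn-alternates : ∀ n → sgn (a + + suc n) ≡ - sgn (a + + n)
  sgn-alternates n = trans (cong sgn (ring a (+ n))) (sgn-suc (a + + n))
    where ring : ∀ a m → a + (1ℤ + m) ≡ 1ℤ + (a + m)
          ring = solve-∀

lemma5p5 : (t a b r : ℤ) → + 2 ≤ a → + 1 ≤ b → f t a b r ≡ g t a b r
lemma5p5 t a@(+ suc (suc p)) b r (+≤+ (s≤s (s≤s z≤n))) _ = begin
  f t a b r                                                ≡⟨ +-identityʳ (f t a b r) ⟨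
  sumFrom1 N fTerm + 0ℤ                                    ≡⟨ cong (λ z → sumFrom1 N fTerm + z) (*-zeroʳ (sgn (a + + 0))) ⟨
  sumFrom1 N fTerm + sgn (a + + 0) * boundary (+ 0)        ≡⟨ sumFrom1-telescope (λ i → sgn (a + i)) fTerm gTerm boundary
                                                                sgn-alternates fTerm≡gTerm+Δboundary N ⟩
  sumFrom1 N gTerm + sgn (a + + N) * boundary (+ N)        ≡⟨ cong₂ (λ s y → sumFrom1 N gTerm + s * (binom (t - + 2) (+ p) * binom y (b - 1ℤ)))
                                                                (sgnℕ[n+suc[n]]≡-1 p) (ring₁ t r (+ p)) ⟩
  sumFrom1 N gTerm + -1ℤ * T                               ≡⟨ ring₂ (sumFrom1 N gTerm) T ⟩
  g t a b r                                                ∎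
  where
  open ≡-Reasoning
  open Summands t a b r
  N = suc p
  T = binom (t - + 2) (+ p) * binom (t - + 2 + r) (b - 1ℤ)
  ring₁ : ∀ t r q → 1ℤ + (t - + 2 - (1ℤ + (1ℤ + q)) + r + (1ℤ + q)) ≡ t - + 2 + r
  ring₁ = solve-∀
  ring₂ : ∀ S T → S + -1ℤ * T ≡ - T + S
  ring₂ = solve-∀
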